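{- $\mathfrak{r}_{\mathrm{game}}^{\mathrm{II}} = \mathfrak{c}$.
   Context: For $x \subseteq \omega$ and $y \in [\omega]^\omega$, $y$ reaps $x$ if $y \setminus x$ is finite or $y \cap x$ is finite. For $\mathcal{A} \subseteq [\omega]^\omega$, the reaping game with respect to $\mathcal{A}$ is: in round $k$ Player I plays a natural number $n_k$, subject to $n_0 < n_1 < n_2 < \cdots$, and then Player II plays $i_k \in \{0,1\}$. Player II wins if there is $A \in \mathcal{A}$ such that $\{n_k : k \in \omega\} \cap A = \{n_k : k \in \omega,\ i_k = 1\}$ and $A$ reaps $\{n_k : k \in \omega\}$; otherwise Player I wins. Strategies and winning strategies are meant in the usual sense. Define $\mathfrak{r}_{\mathrm{game}}^{\mathrm{II}} = \min\{|\mathcal{A}| : \mathcal{A} \subseteq [\omega]^\omega \text{ and Player II has a winning strategy in the reaping game with respect to } \mathcal{A}\}$. $\mathfrak{c}$ is the cardinality of the continuum. -}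

module Defs where

open import Data.Nat using (ℕ; suc; _≤_; _<_)
open import Data.Bool using (Bool; true; false)
open import Data.List using (List; map; upTo)
open import Data.Product using (Σ; ∃; _×_)
open import Data.Sum using (_⊎_)
open import Relation.Binary.PropositionalEquality using (_≡_)

Subset : Set
Subset = ℕ → Bool

Infinite : Subset → Set
Infinite x = ∀ m → ∃ λ j → m ≤ j × x j ≡ true

Family : Set₁
Family = Subset → Set

InfiniteFamily : Family → Set
InfiniteFamily 𝒜 = ∀ A → 𝒜 A → Infinite A

-- A strictly increasing sequence n₀ < n₁ < … (the moves of Player I).
StrictlyIncreasing : (ℕ → ℕ) → Set
StrictlyIncreasing n = ∀ k → n k < n (suc k)

RangeOf : (ℕ → ℕ) → ℕ → Set
RangeOf n j = ∃ λ k → n k ≡ j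

DiffFinite : Subset → (ℕ → ℕ) → Set
DiffFinite A n = ∃ λ m → ∀ j → m ≤ j → A j ≡ true → RangeOf n j

InterFinite : Subset → (ℕ → ℕ) → Set
InterFinite A n = ∃ λ m → ∀ k → m ≤ n k → A (n k) ≡ false

Reaps : Subset → (ℕ → ℕ) → Set
Reaps A n = DiffFinite A n ⊎ InterFinite A n

-- A strategy for Player II: given Player I's moves n₀,…,n_k so far
-- (Player II's earlier answers are determined by the strategy), answer i_k.
StrategyII : Set
StrategyII = List ℕ → Bool

history : (ℕ → ℕ) → ℕ → List ℕ
history n k = map n (upTo (suc k))

answer : StrategyII → (ℕ → ℕ) → ℕ → Bool
answer σ n k = σ (history n k)

-- Player II wins the play: some A ∈ 𝒜 has range(n) ∩ A = {n_k : i_k = 1}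
-- (equivalently, since n is injective, A(n_k) = i_k for all k) and A reaps range(n).
IIWins : Family → StrategyII → (ℕ → ℕ) → Set
IIWins 𝒜 σ n = Σ Subset λ A → 𝒜 A × (∀ k → A (n k) ≡ answer σ n k) × Reaps A n

WinningStrategyII : Family → StrategyII → Set
WinningStrategyII 𝒜 σ = ∀ n → StrictlyIncreasing n → IIWins 𝒜 σ n

IIHasWinningStrategy : Family → Set
IIHasWinningStrategy 𝒜 = Σ StrategyII λ σ → WinningStrategyII 𝒜 σ

_≐_ : Subset → Subset → Set
x ≐ y = ∀ j → x j ≡ y j

-- |𝒜| ≥ 𝔠: an injection (up to extensional equality) of 2^ω into 𝒜.
ContinuumMany : Family → Set
ContinuumMany 𝒜 = Σ (Subset → Subset) λ f →
  (∀ x → 𝒜 (f x)) × (∀ x y → f x ≐ f y → x ≐ y)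

-- Upper bound: against the family of all infinite sets, Player II wins by always answering 1,
-- with A = {n_k : k ∈ ω}.
--
-- Lower bound: fix a winning strategy σ for 𝒜. Build a binary tree of finite positions in
-- which σ's last answer is 1: to extend a position, Player I plays F, F+1, F+2, … for a
-- fresh F; the set II wins with is infinite, so it contains one of these moves, and there
-- σ answers 1. Each node adds an interval of moves, and taking F above everything built
-- so far makes the intervals of distinct nodes disjoint. A branch x ∈ 2^ω yields a play
-- and a winning set A_x ∈ 𝒜 containing the final moves of all nodes on the branch. If
-- A_x = A_y, then A_y cannot meet the play of y finitely, so it is almost contained in it;
-- hence the final moves of deep nodes of x are moves of y, so the branches share those
-- nodes and x = y.
module Submission where

open import Defs
open import Data.Bool using (Bool; true; false; if_then_else_)
open import Data.List.Properties using (map-cong-local)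
open import Data.List.Relation.Unary.All.Properties using (applyUpTo⁺₁)
open import Data.Nat
open import Data.Nat.Properties
open import Data.Product using (Σ; ∃; _×_; _,_; proj₁; proj₂)
open import Data.Sum using (inj₁; inj₂; [_,_]′)
open import Function using (id)
open import Relation.Nullary using (¬_; yes; no; does; contradiction)
open import Relation.Nullary.Decidable using (dec-true; dec-false)
open import Relation.Binary.Definitions using (tri<; tri≈; tri>)
open import Relation.Binary.PropositionalEquality

strictlyIncreasing⇒monotone : ∀ {f} → StrictlyIncreasing f → ∀ {i k} → i ≤ k → f i ≤ f k
strictlyIncreasing⇒monotone {f} inc i≤k = go (≤⇒≤′ i≤k)
  where
    go : ∀ {i k} → i ≤′ k → f i ≤ f k
    go (≤′-reflexive refl) = ≤-refl
    go (≤′-step i≤′k)      = ≤-trans (go i≤′k) (<⇒≤ (inc _))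

strictlyIncreasing⇒inflationary : ∀ {f} → StrictlyIncreasing f → ∀ k → k ≤ f k
strictlyIncreasing⇒inflationary inc zero    = z≤n
strictlyIncreasing⇒inflationary inc (suc k) = ≤-<-trans (strictlyIncreasing⇒inflationary inc k) (inc k)

history-cong : ∀ {n n′} k → (∀ i → i ≤ k → n i ≡ n′ i) → history n k ≡ history n′ k
history-cong k agree = map-cong-local (applyUpTo⁺₁ id (suc k) (λ i<1+k → agree _ (s≤s⁻¹ i<1+k)))

-- A play given by its gaps h: every strictly increasing sequence has this form.
fromGaps : (ℕ → ℕ) → ℕ → ℕ
fromGaps h zero    = h zero
fromGaps h (suc k) = suc (fromGaps h k + h (suc k))

fromGaps-increasing : ∀ h → StrictlyIncreasing (fromGaps h)
fromGaps-increasing h k = s≤s (m≤m+n (fromGaps h k) (h (suc k)))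

gap≤fromGaps : ∀ h k → h k ≤ fromGaps h k
gap≤fromGaps h zero    = ≤-refl
gap≤fromGaps h (suc k) = m≤n⇒m≤1+n (m≤n+m (h (suc k)) (fromGaps h k))

fromGaps-cong : ∀ {h h′} k → (∀ i → i ≤ k → h i ≡ h′ i) → fromGaps h k ≡ fromGaps h′ k
fromGaps-cong zero    agree = agree zero z≤n
fromGaps-cong (suc k) agree = cong₂ (λ a b → suc (a + b))
  (fromGaps-cong k (λ i i≤k → agree i (m≤n⇒m≤1+n i≤k))) (agree (suc k) ≤-refl)

-- The first L gaps of g, then a jump to at least F, then consecutive moves.
graft : (ℕ → ℕ) → ℕ → ℕ → ℕ → ℕ
graft g zero    F zero    = F
graft g zero    F (suc i) = 0
graft g (suc L) F zero    = g zero
graft g (suc L) F (suc i) = graft (λ i → g (suc i)) L F i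

graft-< : ∀ g L F i → i < L → graft g L F i ≡ g i
graft-< g (suc L) F zero    _         = refl
graft-< g (suc L) F (suc i) (s≤s i<L) = graft-< (λ i → g (suc i)) L F i i<L

graft-≡ : ∀ g L F → graft g L F L ≡ F
graft-≡ g zero    F = refl
graft-≡ g (suc L) F = graft-≡ (λ i → g (suc i)) L F

graft-> : ∀ g L F d → graft g L F (suc (L + d)) ≡ 0
graft-> g zero    F d = refl
graft-> g (suc L) F d = graft-> (λ i → g (suc i)) L F d

fromGaps-graft-< : ∀ g L F k → k < L → fromGaps (graft g L F) k ≡ fromGaps g k
fromGaps-graft-< g L F k k<L = fromGaps-cong k (λ i i≤k → graft-< g L F i (≤-<-trans i≤k k<L))

F≤fromGaps-graft : ∀ g L F → F ≤ fromGaps (graft g L F) L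
F≤fromGaps-graft g L F =
  subst (_≤ fromGaps (graft g L F) L) (graft-≡ g L F) (gap≤fromGaps (graft g L F) L)

fromGaps-graft-+ : ∀ g L F d → fromGaps (graft g L F) (L + d) ≡ fromGaps (graft g L F) L + d
fromGaps-graft-+ g L F zero    =
  trans (cong (fromGaps (graft g L F)) (+-identityʳ L)) (sym (+-identityʳ _))
fromGaps-graft-+ g L F (suc d) = begin
  fromGaps h (L + suc d)                     ≡⟨ cong (fromGaps h) (+-suc L d) ⟩
  suc (fromGaps h (L + d) + h (suc (L + d))) ≡⟨ cong₂ (λ a b → suc (a + b))
                                                      (fromGaps-graft-+ g L F d) (graft-> g L F d) ⟩
  suc (fromGaps h L + d + 0)                 ≡⟨ cong suc (+-identityʳ _) ⟩
  suc (fromGaps h L + d)                     ≡⟨ sym (+-suc (fromGaps h L) d) ⟩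
  fromGaps h L + suc d                       ∎
  where
    open ≡-Reasoning
    h = graft g L F

-- Heap numbering of the full binary tree: the children of n are 2n+1 and 2n+2.
shiftIn : Bool → ℕ → ℕ
shiftIn false n = n + n
shiftIn true  n = suc (n + n)

child : Bool → ℕ → ℕ
child b n = suc (shiftIn b n)

parent : ℕ → ℕ
parent t = ⌊ pred t /2⌋

parent-child : ∀ b n → parent (child b n) ≡ n
parent-child false n = sym (n≡⌊n+n/2⌋ n)
parent-child true  n = sym (n≡⌈n+n/2⌉ n)

child-injective : ∀ {b b′ n n′} → child b n ≡ child b′ n′ → b ≡ b′ × n ≡ n′
child-injective {b} {b′} {n} {n′} eq
  with trans (sym (parent-child b n)) (trans (cong parent eq) (parent-child b′ n′))
child-injective {false} {false} eq | refl = refl , refl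
child-injective {true}  {true}  eq | refl = refl , refl
child-injective {false} {true}  eq | refl = contradiction (sym (suc-injective eq)) 1+n≢n
child-injective {true}  {false} eq | refl = contradiction (suc-injective eq) 1+n≢n

branch : Subset → ℕ → ℕ
branch x zero    = zero
branch x (suc m) = child (x m) (branch x m)

branch-injective : ∀ x y {m m′} → branch x m ≡ branch y m′ → m ≡ m′ × (∀ i → i < m → x i ≡ y i)
branch-injective x y {zero}  {zero}   eq = refl , λ _ ()
branch-injective x y {zero}  {suc m′} ()
branch-injective x y {suc m} {zero}   ()
branch-injective x y {suc m} {suc m′} eq with child-injective {x m} {y m′} {branch x m} {branch y m′} eq
... | xm≡ym′ , eq′ with branch-injective x y {m} {m′} eq′
... | refl , agree =
  refl , λ { i (s≤s i≤m) → [ agree i , (λ { refl → xm≡ym′ }) ]′ (m≤n⇒m<n∨m≡n i≤m) }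

branch-increasing : ∀ x → StrictlyIncreasing (branch x)
branch-increasing x m with x m
... | false = s≤s (m≤n+m (branch x m) (branch x m))
... | true  = s≤s (m≤n⇒m≤1+n (m≤n+m (branch x m) (branch x m)))

module LowerBound (𝒜 : Family) (infinite : InfiniteFamily 𝒜)
                  (σ : StrategyII) (win : WinningStrategyII 𝒜 σ) where

  record Position : Set where
    field
      gaps     : ℕ → ℕ
      last     : ℕ
      accepted : σ (history (fromGaps gaps) last) ≡ true

    move : ℕ → ℕ
    move = fromGaps gaps

    top : ℕ
    top = move last

  open Position

  -- Player I continues the prefix with F, F+1, F+2, …; II's winning set contains some move j
  -- after the jump, and the new position ends there.
  extend : (ℕ → ℕ) → ℕ → ℕ → Position
  extend g L F = record { gaps = h ; last = L + (j ∸ n L) ; accepted = σ-answers-1 }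
    where
      h = graft g L F
      n = fromGaps h
      W = win n (fromGaps-increasing h)
      A = proj₁ W
      hit = infinite A (proj₁ (proj₂ W)) (n L)
      j = proj₁ hit
      n[last]≡j : n (L + (j ∸ n L)) ≡ j
      n[last]≡j = trans (fromGaps-graft-+ g L F (j ∸ n L)) (m+[n∸m]≡n (proj₁ (proj₂ hit)))
      open ≡-Reasoning
      σ-answers-1 : σ (history n (L + (j ∸ n L))) ≡ true
      σ-answers-1 = begin
        σ (history n (L + (j ∸ n L))) ≡⟨ sym (proj₁ (proj₂ (proj₂ W)) (L + (j ∸ n L))) ⟩
        A (n (L + (j ∸ n L)))         ≡⟨ cong A n[last]≡j ⟩
        A j                           ≡⟨ proj₂ (proj₂ hit) ⟩
        true                          ∎

  extend-new : ∀ g L F k → L ≤ k → k ≤ last (extend g L F) →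
               F ≤ move (extend g L F) k × move (extend g L F) k ≤ top (extend g L F)
  extend-new g L F k L≤k k≤last =
    ≤-trans (F≤fromGaps-graft g L F) (mono L≤k) , mono k≤last
    where mono = strictlyIncreasing⇒monotone (fromGaps-increasing (graft g L F))

  continue : Position → ℕ → Position
  continue p F = extend (gaps p) (suc (last p)) F

  continue-last : ∀ p F → last p < last (continue p F)
  continue-last p F = m≤m+n (suc (last p)) _

  continue-move : ∀ p F k → k ≤ last p → move (continue p F) k ≡ move p k
  continue-move p F k k≤last = fromGaps-graft-< (gaps p) (suc (last p)) F k (s≤s k≤last)

  F≤top-continue : ∀ p F → F ≤ top (continue p F)
  F≤top-continue p F = proj₁ (extend-new (gaps p) (suc (last p)) F _ (continue-last p F) ≤-refl)

  root : Position
  root = extend (λ _ → 0) 0 0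

  -- Course-of-values table: stage t u is node u for every u ≤ t.
  stage : ℕ → ℕ → Position
  stage zero    u = root
  stage (suc t) u = if does (u ≤? t) then stage t u
                    else continue (stage t (parent (suc t))) (suc (top (stage t t)))

  node : ℕ → Position
  node t = stage t t

  start : ℕ → ℕ
  start zero    = 0
  start (suc t) = suc (top (node t))

  stage-suc : ∀ {t u} → u ≤ t → stage (suc t) u ≡ stage t u
  stage-suc {t} {u} u≤t rewrite dec-true (u ≤? t) u≤t = refl

  stage-stable : ∀ {t u} → u ≤ t → stage t u ≡ node u
  stage-stable {zero}  z≤n = refl
  stage-stable {suc t} u≤1+t with m≤n⇒m<n∨m≡n u≤1+t
  ... | inj₁ (s≤s u≤t) = trans (stage-suc u≤t) (stage-stable u≤t)
  ... | inj₂ refl      = refl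

  node-suc : ∀ t → node (suc t) ≡ continue (node (parent (suc t))) (start (suc t))
  node-suc t rewrite dec-false (suc t ≤? t) 1+n≰n =
    cong (λ p → continue p (start (suc t))) (stage-stable (⌊n/2⌋≤n t))

  top-increasing : StrictlyIncreasing (λ t → top (node t))
  top-increasing t = subst (λ p → start (suc t) ≤ top p) (sym (node-suc t))
    (F≤top-continue (node (parent (suc t))) (start (suc t)))

  -- The moves added by node t lie in this interval.
  Segment : ℕ → ℕ → Set
  Segment t p = start t ≤ p × p ≤ top (node t)

  top∈Segment : ∀ t → Segment t (top (node t))
  top∈Segment zero    = z≤n , ≤-refl
  top∈Segment (suc t) = top-increasing t , ≤-refl

  Segment-disjoint : ∀ {t u p} → t < u → Segment t p → ¬ Segment u p
  Segment-disjoint {u = suc u} (s≤s t≤u) (_ , p≤top) (start≤p , _) =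
    <⇒≱ start≤p (≤-trans p≤top (strictlyIncreasing⇒monotone top-increasing t≤u))

  Segment-unique : ∀ {t u p} → Segment t p → Segment u p → t ≡ u
  Segment-unique {t} {u} p∈t p∈u with <-cmp t u
  ... | tri< t<u _ _ = contradiction p∈u (Segment-disjoint t<u p∈t)
  ... | tri≈ _ t≡u _ = t≡u
  ... | tri> _ _ u<t = contradiction p∈t (Segment-disjoint u<t p∈u)

  -- Equal to node ∘ branch x (node-branch), but unfolding definitionally along the branch.
  along : Subset → ℕ → Position
  along x zero    = root
  along x (suc m) = continue (along x m) (start (branch x (suc m)))

  node-branch : ∀ x m → node (branch x m) ≡ along x m
  node-branch x zero    = refl
  node-branch x (suc m) = begin
    node (child (x m) (branch x m))
      ≡⟨ node-suc (shiftIn (x m) (branch x m)) ⟩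
    continue (node (parent (child (x m) (branch x m)))) (start (branch x (suc m)))
      ≡⟨ cong (λ t → continue (node t) (start (branch x (suc m)))) (parent-child (x m) (branch x m)) ⟩
    continue (node (branch x m)) (start (branch x (suc m)))
      ≡⟨ cong (λ p → continue p (start (branch x (suc m)))) (node-branch x m) ⟩
    along x (suc m) ∎
    where open ≡-Reasoning

  last-increasing : ∀ x → StrictlyIncreasing (λ m → last (along x m))
  last-increasing x m = continue-last (along x m) (start (branch x (suc m)))

  gaps-stable : ∀ x {m m′ i} → m ≤′ m′ → i ≤ last (along x m) →
                gaps (along x m′) i ≡ gaps (along x m) i
  gaps-stable x (≤′-reflexive refl) _ = refl
  gaps-stable x {m} {suc m′} {i} (≤′-step m≤′m′) i≤last = trans
    (graft-< (gaps (along x m′)) (suc (last (along x m′))) (start (branch x (suc m′))) i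
      (s≤s (≤-trans i≤last (strictlyIncreasing⇒monotone (last-increasing x) (≤′⇒≤ m≤′m′)))))
    (gaps-stable x m≤′m′ i≤last)

  -- The prefixes along x stabilise (gaps-stable), so the diagonal gives their limit.
  branchGaps : Subset → ℕ → ℕ
  branchGaps x i = gaps (along x i) i

  branchGaps-agrees : ∀ x m {i} → i ≤ last (along x m) → branchGaps x i ≡ gaps (along x m) i
  branchGaps-agrees x m {i} i≤last with ≤-total i m
  ... | inj₁ i≤m = sym (gaps-stable x (≤⇒≤′ i≤m) (strictlyIncreasing⇒inflationary (last-increasing x) i))
  ... | inj₂ m≤i = gaps-stable x (≤⇒≤′ m≤i) i≤last

  play : Subset → ℕ → ℕ
  play x = fromGaps (branchGaps x)

  play-agrees : ∀ x m {k} → k ≤ last (along x m) → play x k ≡ move (along x m) k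
  play-agrees x m {k} k≤last = fromGaps-cong k (λ i i≤k → branchGaps-agrees x m (≤-trans i≤k k≤last))

  play-last : ∀ x m → play x (last (along x m)) ≡ top (node (branch x m))
  play-last x m = trans (play-agrees x m ≤-refl) (cong top (sym (node-branch x m)))

  move∈Segment-along : ∀ x m k → k ≤ last (along x m) →
                       ∃ λ m′ → Segment (branch x m′) (move (along x m) k)
  move∈Segment-along x zero k k≤last =
    zero , z≤n , strictlyIncreasing⇒monotone (fromGaps-increasing (gaps root)) k≤last
  move∈Segment-along x (suc m) k k≤last with k ≤? last (along x m)
  ... | yes k≤ = subst (λ p → ∃ λ m′ → Segment (branch x m′) p)
                   (sym (continue-move (along x m) F k k≤)) (move∈Segment-along x m k k≤)
    where F = start (branch x (suc m))
  ... | no k≰ =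
    suc m , proj₁ new , subst (move (along x (suc m)) k ≤_) (cong top (sym (node-branch x (suc m)))) (proj₂ new)
    where new = extend-new (gaps (along x m)) (suc (last (along x m))) (start (branch x (suc m))) k (≰⇒> k≰) k≤last

  play∈Segment : ∀ x k → ∃ λ m → Segment (branch x m) (play x k)
  play∈Segment x k = subst (λ p → ∃ λ m → Segment (branch x m) p)
                       (sym (play-agrees x k k≤last)) (move∈Segment-along x k k k≤last)
    where k≤last = strictlyIncreasing⇒inflationary (last-increasing x) k

  wins : ∀ x → IIWins 𝒜 σ (play x)
  wins x = win (play x) (fromGaps-increasing (branchGaps x))

  branchSet : Subset → Subset
  branchSet x = proj₁ (wins x)

  branchSet-last : ∀ x m → branchSet x (play x (last (along x m))) ≡ true
  branchSet-last x m = begin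
    branchSet x (play x K)           ≡⟨ proj₁ (proj₂ (proj₂ (wins x))) K ⟩
    σ (history (play x) K)           ≡⟨ cong σ (history-cong K (λ i i≤K → play-agrees x m i≤K)) ⟩
    σ (history (move (along x m)) K) ≡⟨ accepted (along x m) ⟩
    true                             ∎
    where
      open ≡-Reasoning
      K = last (along x m)

  top∈branchSet : ∀ x m → branchSet x (top (node (branch x m))) ≡ true
  top∈branchSet x m = subst (λ p → branchSet x p ≡ true) (play-last x m) (branchSet-last x m)

  m≤top : ∀ x m → m ≤ top (node (branch x m))
  m≤top x m = ≤-trans (strictlyIncreasing⇒inflationary (branch-increasing x) m)
                      (strictlyIncreasing⇒inflationary top-increasing (branch x m))

  ¬InterFinite : ∀ x → ¬ InterFinite (branchSet x) (play x)
  ¬InterFinite x (M , outside) =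
    contradiction (trans (sym (branchSet-last x M)) (outside K M≤play)) λ ()
    where
      K = last (along x M)
      M≤play = subst (M ≤_) (sym (play-last x M)) (m≤top x M)

  branchSet-injective : ∀ x y → branchSet x ≐ branchSet y → x ≐ y
  branchSet-injective x y same j with proj₂ (proj₂ (proj₂ (wins y)))
  ... | inj₂ interFinite   = contradiction interFinite (¬InterFinite y)
  ... | inj₁ (M , almostIn) = proj₂ shared j (s≤s (m≤n+m j M))
    where
      m = suc (M + j)
      p = top (node (branch x m))
      hit = almostIn p (≤-trans (m≤n⇒m≤1+n (m≤m+n M j)) (m≤top x m))
                       (trans (sym (same p)) (top∈branchSet x m))
      owner = play∈Segment y (proj₁ hit)
      shared = branch-injective x y
        (Segment-unique (top∈Segment (branch x m)) (subst (Segment _) (proj₂ hit) (proj₂ owner)))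

  continuumMany : ContinuumMany 𝒜
  continuumMany = branchSet , (λ x → proj₁ (proj₂ (wins x))) , branchSet-injective

rangeSet : (ℕ → ℕ) → Subset
rangeSet n j = does (anyUpTo? (λ k → n k ≟ j) (suc j))

rangeSet-complete : ∀ {n} → StrictlyIncreasing n → ∀ k → rangeSet n (n k) ≡ true
rangeSet-complete {n} inc k =
  dec-true (anyUpTo? (λ i → n i ≟ n k) (suc (n k))) (k , s≤s (strictlyIncreasing⇒inflationary inc k) , refl)

rangeSet-sound : ∀ n j → rangeSet n j ≡ true → RangeOf n j
rangeSet-sound n j j∈ with anyUpTo? (λ k → n k ≟ j) (suc j)
... | yes (k , _ , nk≡j) = k , nk≡j

alwaysOne : StrategyII
alwaysOne _ = true

alwaysOne-wins : WinningStrategyII Infinite alwaysOne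
alwaysOne-wins n inc =
  rangeSet n , infinite , rangeSet-complete inc , inj₁ (0 , λ j _ → rangeSet-sound n j)
  where
    infinite : Infinite (rangeSet n)
    infinite m = n m , strictlyIncreasing⇒inflationary inc m , rangeSet-complete inc m

theorem4p1 : Σ Family (λ 𝒜 → InfiniteFamily 𝒜 × IIHasWinningStrategy 𝒜)
             × (∀ 𝒜 → InfiniteFamily 𝒜 → IIHasWinningStrategy 𝒜 → ContinuumMany 𝒜)
theorem4p1 = (Infinite , (λ _ infinite → infinite) , alwaysOne , alwaysOne-wins)
           , λ 𝒜 infinite (σ , win) → LowerBound.continuumMany 𝒜 infinite σ win
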